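{- Let $\mathcal{A}$ be a finite alphabet and let $s$ be a balanced standard episturmian sequence over $\mathcal{A}$ containing at least three distinct letters. Suppose a directive sequence of $s$ is $\Delta(s)=a\,y\,a^{\ell}z$ with $a\in\mathcal{A}$, $\ell\ge2$, $y\in\mathcal{A}^+$ nonempty with pairwise distinct letters and $|y|_a=0$, and $z\in\mathcal{A}^{\omega}$. Then $\Delta(s)=a\,y\,a^{\omega}$ (i.e. up to renaming, $\Delta(s)=123\cdots k\,1^{\omega}$).
   Context: For a finite word $w$, $w^{(+)}$ denotes the shortest palindrome having $w$ as a prefix. For an infinite word $\Delta=x_1x_2\cdots$ set $u_1=\varepsilon$, $u_{n+1}=(u_nx_n)^{(+)}$. An infinite word $s$ is standard episturmian if there exists an infinite word $\Delta$ (a directive sequence of $s$) such that every $u_n$ is a prefix of $s$. A word is balanced if for any two factors $u,v$ of the same length and every letter $b$, $||u|_b-|v|_b|\le1$, where $|u|_b$ counts occurrences of $b$ in $u$. -}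

module Defs where

open import Data.Nat using (ℕ; zero; suc; _+_; _≤_; ∣_-_∣)
open import Data.Fin using (Fin)
open import Data.Fin.Properties using (_≟_)
open import Data.List using (List; []; _∷_; _++_; _∷ʳ_; reverse; length; filter; replicate)
open import Data.Product using (Σ; ∃; _×_; _,_)
open import Relation.Binary.PropositionalEquality using (_≡_; _≢_)

-- The finite alphabet is Fin k (any finite alphabet, up to renaming).
Letter : ℕ → Set
Letter k = Fin k

Word : ℕ → Set
Word k = List (Letter k)

InfWord : ℕ → Set
InfWord k = ℕ → Letter k

occ : ∀ {k} → Letter k → Word k → ℕ
occ b w = length (filter (b ≟_) w)

IsPrefix : ∀ {k} → Word k → Word k → Set
IsPrefix w p = ∃ λ t → w ++ t ≡ p

IsPalindrome : ∀ {k} → Word k → Set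
IsPalindrome w = reverse w ≡ w

IsPalClosure : ∀ {k} → Word k → Word k → Set
IsPalClosure w p =
  IsPalindrome p × IsPrefix w p ×
  (∀ q → IsPalindrome q → IsPrefix w q → length p ≤ length q)

pre : ∀ {k} → InfWord k → ℕ → Word k
pre s zero    = []
pre s (suc n) = s 0 ∷ pre (λ i → s (suc i)) n

factor : ∀ {k} → InfWord k → ℕ → ℕ → Word k
factor s i n = pre (λ j → s (i + j)) n

IsPrefixInf : ∀ {k} → Word k → InfWord k → Set
IsPrefixInf w s = pre s (length w) ≡ w

-- Δ is a directive sequence of s: the palindromic prefixes u_n
-- (u_1 = ε, u_{n+1} = (u_n x_n)^(+)) are all prefixes of s.
-- Here u 0 plays the role of u_1 and Δ 0 the role of x_1.
IsDirective : ∀ {k} → InfWord k → InfWord k → Set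
IsDirective Δ s =
  Σ (ℕ → Word _) λ u →
    (u 0 ≡ []) ×
    (∀ n → IsPalClosure (u n ∷ʳ Δ n) (u (suc n))) ×
    (∀ n → IsPrefixInf (u n) s)

StandardEpisturmian : ∀ {k} → InfWord k → Set
StandardEpisturmian s = ∃ λ Δ → IsDirective Δ s

Balanced : ∀ {k} → InfWord k → Set
Balanced s = ∀ i j n b → ∣ occ b (factor s i n) - occ b (factor s j n) ∣ ≤ 1

AtLeastThreeLetters : ∀ {k} → InfWord k → Set
AtLeastThreeLetters s =
  ∃ λ i → ∃ λ j → ∃ λ m → (s i ≢ s j) × (s i ≢ s m) × (s j ≢ s m)

_++ω_ : ∀ {k} → Word k → InfWord k → InfWord k
([] ++ω z) n = z n
((x ∷ w) ++ω z) zero = x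
((x ∷ w) ++ω z) (suc n) = (w ++ω z) n

constω : ∀ {k} → Letter k → InfWord k
constω a _ = a

{-# OPTIONS --safe #-}

-- Write x_n = Δ n, u_n for the n-th palindromic prefix of s and j = |y|. If x_n does not occur in
-- u_n then u_{n+1} = u_n x_n u_n; this is the case for n ≤ j, and every letter of s is some x_n.
-- Suppose x_N ≠ a for some N > j.
-- * If x_N = y_i, reflecting in the palindrome u_N shows that y_i u_i y_i is a factor of s, while the
--   factor u_i x_{i+1} c following the first y_i has no y_i: c, the letter after u_{i+1}, is a for i < j,
--   and for i = j ≥ 2 reflections in u_{j+2} show c ≠ y_j.
-- * If x_N is a letter outside a y, occurring for the first time, then y_j u_j x_N u_j y_j and
--   a u_{j+1} a are factors of the same length with 2|u_j|_a and 2|u_j|_a + 2 letters a.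
-- Both contradict balance. Finally, j = 1 would leave s with only the two letters a and y_1.
module Submission where

open import Defs
open import Data.Empty using (⊥; ⊥-elim)
open import Data.Fin.Properties using (_≟_)
open import Data.List using ([]; _∷_; _++_; _∷ʳ_; reverse; length; filter; replicate)
open import Data.List.Properties
  using (∷-injectiveˡ; ∷-injectiveʳ; ++-assoc; length-++; length-reverse; unfold-reverse; reverse-++;
         reverse-involutive; filter-++; filter-accept; filter-reject)
open import Data.List.Relation.Binary.Permutation.Propositional.Properties
  using (↭-reverse; filter-↭; ↭-length)
open import Data.List.Relation.Unary.All using (All; []; _∷_)
open import Data.List.Relation.Unary.AllPairs using ([]; _∷_)
open import Data.List.Relation.Unary.Unique.Propositional using (Unique)
open import Data.Nat using (ℕ; zero; suc; _+_; _∸_; _≤_; _<_; z≤n; s≤s)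
open import Data.Nat.Induction using (<-rec)
open import Data.Nat.Properties
  using (≤-refl; ≤-trans; ≤-antisym; <-trans; ≤-<-trans; <-≤-trans; ≤-pred; <-irrefl; 1+n≰n; ≮⇒≥; ≰⇒>;
         <-cmp; _<?_; n<1+n; n≤1+n; m≤m+n; m<m+n; m<1+n⇒m<n∨m≡n; m≤n⇒m<n∨m≡n; +-comm; +-assoc; +-suc;
         +-identityʳ; +-monoʳ-≤; +-monoˡ-<; +-mono-≤; +-cancelˡ-≤; +-cancelˡ-<; +-∸-assoc; n∸n≡0;
         m+n∸n≡m; m+n∸m≡n; m+[n∸m]≡n; m∸n+n≡m; m≤n+∣m-n∣; anyUpTo?)
open import Data.Nat.Tactic.RingSolver using (solve-∀)
open import Data.Product using (∃; _×_; _,_; proj₁; proj₂)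
open import Data.Sum using (_⊎_; inj₁; inj₂)
open import Relation.Binary.Definitions using (tri<; tri≈; tri>)
open import Relation.Binary.PropositionalEquality
  using (_≡_; _≢_; refl; sym; trans; cong; cong₂; subst; subst₂; module ≡-Reasoning)
open import Relation.Nullary using (¬_; yes; no)
open import Relation.Unary using (Decidable)

module _ {k : ℕ} where

  pre-cong : ∀ {f g : InfWord k} n → (∀ i → i < n → f i ≡ g i) → pre f n ≡ pre g n
  pre-cong zero    f≗g = refl
  pre-cong (suc n) f≗g =
    cong₂ _∷_ (f≗g 0 (s≤s z≤n)) (pre-cong n (λ i i<n → f≗g (suc i) (s≤s i<n)))

  pre-injective : ∀ {f g : InfWord k} n → pre f n ≡ pre g n → ∀ i → i < n → f i ≡ g i
  pre-injective (suc n) eq zero    _         = ∷-injectiveˡ eq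
  pre-injective (suc n) eq (suc i) (s≤s i<n) = pre-injective n (∷-injectiveʳ eq) i i<n

  pre-lookup : ∀ (f : InfWord k) n xs c ys → pre f n ≡ xs ++ c ∷ ys → f (length xs) ≡ c
  pre-lookup f zero    []       c ys ()
  pre-lookup f zero    (x ∷ xs) c ys ()
  pre-lookup f (suc n) []       c ys eq = ∷-injectiveˡ eq
  pre-lookup f (suc n) (x ∷ xs) c ys eq = pre-lookup (λ i → f (suc i)) n xs c ys (∷-injectiveʳ eq)

  pre-∷ʳ : ∀ (f : InfWord k) n → pre f (suc n) ≡ pre f n ∷ʳ f n
  pre-∷ʳ f zero    = refl
  pre-∷ʳ f (suc n) = cong (f 0 ∷_) (pre-∷ʳ (λ i → f (suc i)) n)

  pre-+ : ∀ (f : InfWord k) m n → pre f (m + n) ≡ pre f m ++ pre (λ i → f (m + i)) n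
  pre-+ f zero    n = refl
  pre-+ f (suc m) n = cong (f 0 ∷_) (pre-+ (λ i → f (suc i)) m n)

  reverse-pre : ∀ (f : InfWord k) n → reverse (pre f n) ≡ pre (λ i → f (n ∸ suc i)) n
  reverse-pre f zero    = refl
  reverse-pre f (suc n) = begin
    reverse (f 0 ∷ pre f′ n)                  ≡⟨ unfold-reverse (f 0) (pre f′ n) ⟩
    reverse (pre f′ n) ∷ʳ f 0                 ≡⟨ cong (_∷ʳ f 0) (reverse-pre f′ n) ⟩
    pre (λ i → f (suc (n ∸ suc i))) n ∷ʳ f 0
      ≡⟨ cong₂ _∷ʳ_ (pre-cong n (λ i i<n → cong f (sym (+-∸-assoc 1 i<n)))) (cong f (sym (n∸n≡0 n))) ⟩
    pre (λ i → f (n ∸ i)) n ∷ʳ f (n ∸ n)      ≡⟨ pre-∷ʳ (λ i → f (n ∸ i)) n ⟨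
    pre (λ i → f (n ∸ i)) (suc n)             ∎
    where
      open ≡-Reasoning
      f′ : InfWord k
      f′ i = f (suc i)

  factor-+ : ∀ (s : InfWord k) i m n → factor s i (m + n) ≡ factor s i m ++ factor s (i + m) n
  factor-+ s i m n = trans (pre-+ (λ t → s (i + t)) m n)
    (cong (factor s i m ++_) (pre-cong n (λ t _ → cong s (sym (+-assoc i m t)))))

  factor-suc : ∀ (s : InfWord k) i n → factor s i (suc n) ≡ s i ∷ factor s (suc i) n
  factor-suc s i n = cong₂ _∷_ (cong s (+-identityʳ i)) (pre-cong n (λ t _ → cong s (+-suc i t)))

module _ {k : ℕ} where

  palindrome-mirror : ∀ {s : InfWord k} {n p q} → IsPalindrome (pre s n) → suc (p + q) ≡ n → s p ≡ s q
  palindrome-mirror {s} {p = p} {q} pal refl = trans (sym reflected) (cong s (m+n∸m≡n p q))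
    where
      reflected : s (suc (p + q) ∸ suc p) ≡ s p
      reflected = pre-injective {f = λ i → s (suc (p + q) ∸ suc i)} {g = s} (suc (p + q))
                    (trans (sym (reverse-pre s (suc (p + q)))) pal) p (s≤s (m≤m+n p q))

  palindrome-factor : ∀ {s : InfWord k} {n p q} → IsPalindrome (pre s n) → p + q ≡ n →
                      factor s p q ≡ reverse (pre s q)
  palindrome-factor {s} {p = p} {q} pal refl =
    trans (pre-cong q (λ t t<q → palindrome-mirror pal (mirror-sum t t<q))) (sym (reverse-pre s q))
    where
      reassoc : ∀ p t r → suc ((p + t) + r) ≡ p + (r + suc t)
      reassoc = solve-∀
      mirror-sum : ∀ t → t < q → suc ((p + t) + (q ∸ suc t)) ≡ p + q
      mirror-sum t t<q = trans (reassoc p t (q ∸ suc t)) (cong (p +_) (m∸n+n≡m t<q))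

  palindrome-window : ∀ {s : InfWord k} {n p q} r → IsPalindrome (pre s n) → p + q ≡ n →
                      factor s p (q + r) ≡ reverse (pre s q) ++ factor s n r
  palindrome-window {s} {p = p} {q} r pal refl =
    trans (factor-+ s p q r) (cong (_++ factor s (p + q) r) (palindrome-factor pal refl))

  ++-∷-reverse-palindrome : ∀ (xs : Word k) x → IsPalindrome (xs ++ x ∷ reverse xs)
  ++-∷-reverse-palindrome xs x = begin
    reverse (xs ++ x ∷ reverse xs)            ≡⟨ reverse-++ xs _ ⟩
    reverse (x ∷ reverse xs) ++ reverse xs    ≡⟨ cong (_++ reverse xs) (unfold-reverse x (reverse xs)) ⟩
    (reverse (reverse xs) ∷ʳ x) ++ reverse xs ≡⟨ cong (λ w → (w ∷ʳ x) ++ reverse xs) (reverse-involutive xs) ⟩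
    (xs ∷ʳ x) ++ reverse xs                   ≡⟨ ++-assoc xs _ _ ⟩
    xs ++ x ∷ reverse xs                      ∎
    where open ≡-Reasoning

module _ {k : ℕ} where

  occ-++ : ∀ b (xs ys : Word k) → occ b (xs ++ ys) ≡ occ b xs + occ b ys
  occ-++ b xs ys = trans (cong length (filter-++ (b ≟_) xs ys)) (length-++ (filter (b ≟_) xs))

  occ-reverse : ∀ b (xs : Word k) → occ b (reverse xs) ≡ occ b xs
  occ-reverse b xs = ↭-length (filter-↭ (b ≟_) (↭-reverse xs))

  occ-∷-≡ : ∀ b (xs : Word k) → occ b (b ∷ xs) ≡ suc (occ b xs)
  occ-∷-≡ b xs = cong length (filter-accept (b ≟_) refl)

  occ-∷-≢ : ∀ {b x} (xs : Word k) → x ≢ b → occ b (x ∷ xs) ≡ occ b xs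
  occ-∷-≢ xs x≢b = cong length (filter-reject (_ ≟_) (λ b≡x → x≢b (sym b≡x)))

  occ-∷ʳ-≡ : ∀ b (xs : Word k) → occ b (xs ∷ʳ b) ≡ suc (occ b xs)
  occ-∷ʳ-≡ b xs =
    trans (occ-++ b xs (b ∷ [])) (trans (cong (occ b xs +_) (occ-∷-≡ b [])) (+-comm (occ b xs) 1))

  occ-∷ʳ-≢ : ∀ {b x} (xs : Word k) → x ≢ b → occ b (xs ∷ʳ x) ≡ occ b xs
  occ-∷ʳ-≢ {b} xs x≢b =
    trans (occ-++ b xs _) (trans (cong (occ b xs +_) (occ-∷-≢ [] x≢b)) (+-identityʳ _))

  occ-pre≡0 : ∀ {b} {f : InfWord k} n → (∀ i → i < n → f i ≢ b) → occ b (pre f n) ≡ 0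
  occ-pre≡0 zero    avoid = refl
  occ-pre≡0 (suc n) avoid =
    trans (occ-∷-≢ _ (avoid 0 (s≤s z≤n))) (occ-pre≡0 n (λ i i<n → avoid (suc i) (s≤s i<n)))

  occ≡0⇒All≢ : ∀ {b} {xs : Word k} → occ b xs ≡ 0 → All (b ≢_) xs
  occ≡0⇒All≢ {xs = []}     _ = []
  occ≡0⇒All≢ {b} {x ∷ xs} occ≡0 =
    b≢x ∷ occ≡0⇒All≢ (trans (sym (occ-∷-≢ xs (λ x≡b → b≢x (sym x≡b)))) occ≡0)
    where
      b≢x : b ≢ x
      b≢x refl with () ← trans (sym (occ-∷-≡ b xs)) occ≡0

  occ-palindrome-window : ∀ {s : InfWord k} {b n p q} → IsPalindrome (pre s n) → p + suc q ≡ n →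
                          s q ≡ b → s n ≡ b → occ b (factor s p (suc q + 1)) ≡ 2 + occ b (pre s q)
  occ-palindrome-window {s} {b} {n} {p} {q} pal p+q≡n sq≡b sn≡b = begin
    occ b (factor s p (suc q + 1))
      ≡⟨ cong (occ b) (palindrome-window {p = p} {suc q} 1 pal p+q≡n) ⟩
    occ b (reverse (pre s (suc q)) ++ factor s n 1)
      ≡⟨ occ-++ b (reverse (pre s (suc q))) (factor s n 1) ⟩
    occ b (reverse (pre s (suc q))) + occ b (factor s n 1)
      ≡⟨ cong₂ _+_ (occ-reverse b (pre s (suc q))) (cong (occ b) (factor-suc s n 0)) ⟩
    occ b (pre s (suc q)) + occ b (s n ∷ [])
      ≡⟨ cong₂ (λ xs c → occ b xs + occ b (c ∷ [])) (trans (pre-∷ʳ s q) (cong (pre s q ∷ʳ_) sq≡b)) sn≡b ⟩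
    occ b (pre s q ∷ʳ b) + occ b (b ∷ [])
      ≡⟨ cong₂ _+_ (occ-∷ʳ-≡ b (pre s q)) (occ-∷-≡ b []) ⟩
    suc (occ b (pre s q)) + 1
      ≡⟨ +-comm _ 1 ⟩
    2 + occ b (pre s q)
      ∎
    where open ≡-Reasoning

  Balanced⇒occ≢2+occ : ∀ {s : InfWord k} → Balanced s → ∀ i j n b →
                       occ b (factor s i n) ≢ 2 + occ b (factor s j n)
  Balanced⇒occ≢2+occ {s} bal i j n b eq =
    1+n≰n (subst (_≤ suc y) eq (subst (x ≤_) (+-comm y 1) x≤y+1))
    where
      x y : ℕ
      x = occ b (factor s i n)
      y = occ b (factor s j n)
      x≤y+1 : x ≤ y + 1
      x≤y+1 = ≤-trans (m≤n+∣m-n∣ x y) (+-monoʳ-≤ y (bal i j n b))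

module _ {k : ℕ} where

  ++ω-++ : ∀ (xs ys : Word k) w n → ((xs ++ ys) ++ω w) n ≡ (xs ++ω (ys ++ω w)) n
  ++ω-++ []       ys w n       = refl
  ++ω-++ (x ∷ xs) ys w zero    = refl
  ++ω-++ (x ∷ xs) ys w (suc n) = ++ω-++ xs ys w n

  ++ω-prefix : ∀ (xs : Word k) {w w′ i} → i < length xs → (xs ++ω w) i ≡ (xs ++ω w′) i
  ++ω-prefix (x ∷ xs) {i = zero}  _         = refl
  ++ω-prefix (x ∷ xs) {i = suc i} (s≤s i<n) = ++ω-prefix xs i<n

  ++ω-beyond : ∀ (xs : Word k) {w i} → length xs ≤ i → (xs ++ω w) i ≡ w (i ∸ length xs)
  ++ω-beyond []                   _         = refl
  ++ω-beyond (x ∷ xs) {i = suc i} (s≤s n≤i) = ++ω-beyond xs n≤i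

  All-++ω : ∀ {P : Letter k → Set} {xs : Word k} {w i} → All P xs → i < length xs → P ((xs ++ω w) i)
  All-++ω {i = zero}  (px ∷ _)  _         = px
  All-++ω {i = suc i} (_ ∷ pxs) (s≤s i<n) = All-++ω pxs i<n

  Unique-++ω : ∀ {xs : Word k} {w i i′} → Unique xs → i < i′ → i′ < length xs →
               (xs ++ω w) i ≢ (xs ++ω w) i′
  Unique-++ω {i = zero}  {suc i′} (x∉xs ∷ _) _          (s≤s i′<n) = All-++ω x∉xs i′<n
  Unique-++ω {i = suc i} {suc i′} (_ ∷ uniq) (s≤s i<i′) (s≤s i′<n) = Unique-++ω uniq i<i′ i′<n

first-occurrence : ∀ {P : ℕ → Set} → Decidable P → ∀ {n} → P n → ∃ λ m → P m × (∀ i → i < m → ¬ P i)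
first-occurrence {P} P? {n} = <-rec (λ n → P n → First) earliest n
  where
    First : Set
    First = ∃ λ m → P m × (∀ i → i < m → ¬ P i)
    earliest : ∀ n → (∀ {m} → m < n → P m → First) → P n → First
    earliest n rec Pn with anyUpTo? P? n
    ... | yes (m , m<n , Pm) = rec m<n Pm
    ... | no  none           = n , Pn , λ i i<n Pi → none (i , i<n , Pi)

pigeonhole : ∀ {A : Set} {p q x y z : A} → x ≡ p ⊎ x ≡ q → y ≡ p ⊎ y ≡ q → z ≡ p ⊎ z ≡ q →
             x ≢ y → x ≢ z → y ≢ z → ⊥
pigeonhole (inj₁ refl) (inj₁ refl) _           x≢y _   _   = x≢y refl
pigeonhole (inj₂ refl) (inj₂ refl) _           x≢y _   _   = x≢y refl
pigeonhole (inj₁ refl) (inj₂ refl) (inj₁ refl) _   x≢z _   = x≢z refl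
pigeonhole (inj₁ refl) (inj₂ refl) (inj₂ refl) _   _   y≢z = y≢z refl
pigeonhole (inj₂ refl) (inj₁ refl) (inj₁ refl) _   _   y≢z = y≢z refl
pigeonhole (inj₂ refl) (inj₁ refl) (inj₂ refl) _   x≢z _   = x≢z refl

module Directive {k : ℕ} {s Δ : InfWord k} (directive : IsDirective Δ s) where

  private
    u : ℕ → Word k
    u = proj₁ directive

    u₀≡[] : u 0 ≡ []
    u₀≡[] = proj₁ (proj₂ directive)

    u-closure : ∀ n → IsPalClosure (u n ∷ʳ Δ n) (u (suc n))
    u-closure = proj₁ (proj₂ (proj₂ directive))

    pre≡u : ∀ n → pre s (length (u n)) ≡ u n
    pre≡u = proj₂ (proj₂ (proj₂ directive))

    u-extends : ∀ n → ∃ λ t → u n ++ Δ n ∷ t ≡ u (suc n)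
    u-extends n with proj₁ (proj₂ (u-closure n))
    ... | t , eq = t , trans (sym (++-assoc (u n) (Δ n ∷ []) t)) eq

  U : ℕ → ℕ
  U n = length (u n)

  U₀ : U 0 ≡ 0
  U₀ = cong length u₀≡[]

  U-palindrome : ∀ n → IsPalindrome (pre s (U n))
  U-palindrome zero    = subst IsPalindrome (sym (trans (pre≡u 0) u₀≡[])) refl
  U-palindrome (suc n) = subst IsPalindrome (sym (pre≡u (suc n))) (proj₁ (u-closure n))

  U-mirror : ∀ n {p q} → suc (p + q) ≡ U n → s p ≡ s q
  U-mirror n = palindrome-mirror (U-palindrome n)

  s[U]≡Δ : ∀ n → s (U n) ≡ Δ n
  s[U]≡Δ n with u-extends n
  ... | t , eq = pre-lookup s (U (suc n)) (u n) (Δ n) t (trans (pre≡u (suc n)) (sym eq))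

  U<U-suc : ∀ n → U n < U (suc n)
  U<U-suc n with u-extends n
  ... | t , eq = subst (U n <_) (trans (sym (length-++ (u n))) (cong length eq)) (m<m+n (U n) (s≤s z≤n))

  U-suc≤2U+1 : ∀ n → U (suc n) ≤ suc (U n + U n)
  U-suc≤2U+1 n = subst (U (suc n) ≤_) length-w
    (proj₂ (proj₂ (u-closure n)) w (++-∷-reverse-palindrome (u n) (Δ n)) (reverse (u n) , ++-assoc (u n) _ _))
    where
      w : Word k
      w = u n ++ Δ n ∷ reverse (u n)
      length-w : length w ≡ suc (U n + U n)
      length-w = trans (length-++ (u n))
        (trans (cong (λ m → U n + suc m) (length-reverse (u n))) (+-suc (U n) (U n)))

  U-strictMono : ∀ {m n} → m < n → U m < U n
  U-strictMono {m} {suc n} m<1+n with m<1+n⇒m<n∨m≡n m<1+n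
  ... | inj₁ m<n  = <-trans (U-strictMono m<n) (U<U-suc n)
  ... | inj₂ refl = U<U-suc m

  n≤U : ∀ n → n ≤ U n
  n≤U zero    = z≤n
  n≤U (suc n) = ≤-trans (s≤s (n≤U n)) (U<U-suc n)

  occurs-earlier : ∀ n x → x < U n → ∃ λ m → m < n × s x ≡ Δ m
  occurs-earlier zero x x<U₀ with () ← subst (x <_) U₀ x<U₀
  occurs-earlier (suc n) x x<U with <-cmp x (U n)
  ... | tri< x<Uₙ _ _ = let m , m<n , eq = occurs-earlier n x x<Uₙ in m , <-trans m<n (n<1+n n) , eq
  ... | tri≈ _ refl _ = n , n<1+n n , s[U]≡Δ n
  ... | tri> _ _ Uₙ<x = let m , m<n , eq = occurs-earlier n b b<Uₙ in
                        m , <-trans m<n (n<1+n n) , trans (U-mirror (suc n) x+b) eq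
    where
      b : ℕ
      b = U (suc n) ∸ suc x
      x+b : suc (x + b) ≡ U (suc n)
      x+b = m+[n∸m]≡n x<U
      b<Uₙ : b < U n
      b<Uₙ = +-cancelˡ-< (U n) b (U n) (<-≤-trans (+-monoˡ-< b Uₙ<x)
               (≤-pred (subst (_≤ suc (U n + U n)) (sym x+b) (U-suc≤2U+1 n))))

  Fresh : ℕ → Set
  Fresh n = ∀ x → x < U n → s x ≢ Δ n

  module _ {n} (fresh : Fresh n) where

    fresh⇒U-suc : U (suc n) ≡ suc (U n + U n)
    fresh⇒U-suc = ≤-antisym (U-suc≤2U+1 n)
      (subst (suc (U n + U n) ≤_) Uₙ+b (s≤s (+-monoʳ-≤ (U n) (≮⇒≥ b≮Uₙ))))
      where
        b : ℕ
        b = U (suc n) ∸ suc (U n)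
        Uₙ+b : suc (U n + b) ≡ U (suc n)
        Uₙ+b = m+[n∸m]≡n (U<U-suc n)
        b≮Uₙ : ¬ b < U n
        b≮Uₙ b<Uₙ = fresh b b<Uₙ (trans (sym (U-mirror (suc n) Uₙ+b)) (s[U]≡Δ n))

    fresh⇒s-copy : ∀ t → t < U n → s (suc (U n + t)) ≡ s t
    fresh⇒s-copy t t<Uₙ =
      trans (U-mirror (suc n) outer) (U-mirror n (trans (cong suc (+-comm r t)) t+r))
      where
        r : ℕ
        r = U n ∸ suc t
        t+r : suc (t + r) ≡ U n
        t+r = m+[n∸m]≡n t<Uₙ
        reassoc : ∀ m t r → suc (suc (m + t) + r) ≡ suc (m + suc (t + r))
        reassoc = solve-∀
        outer : suc (suc (U n + t) + r) ≡ U (suc n)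
        outer = trans (reassoc (U n) t r) (trans (cong (λ m → suc (U n + m)) t+r) (sym fresh⇒U-suc))

    fresh⇒factor≡pre : ∀ {q} → q ≤ U n → factor s (suc (U n)) q ≡ pre s q
    fresh⇒factor≡pre {q} q≤Uₙ = pre-cong q (λ t t<q → fresh⇒s-copy t (<-≤-trans t<q q≤Uₙ))

    fresh⇒pre-U-suc : pre s (U (suc n)) ≡ pre s (U n) ++ Δ n ∷ pre s (U n)
    fresh⇒pre-U-suc = begin
      pre s (U (suc n))
        ≡⟨ cong (pre s) fresh⇒U-suc ⟩
      pre s (suc (U n) + U n)
        ≡⟨ pre-+ s (suc (U n)) (U n) ⟩
      pre s (suc (U n)) ++ factor s (suc (U n)) (U n)
        ≡⟨ cong₂ _++_ (pre-∷ʳ s (U n)) (fresh⇒factor≡pre ≤-refl) ⟩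
      (pre s (U n) ∷ʳ s (U n)) ++ pre s (U n)
        ≡⟨ ++-assoc (pre s (U n)) _ _ ⟩
      pre s (U n) ++ s (U n) ∷ pre s (U n)
        ≡⟨ cong (λ c → pre s (U n) ++ c ∷ pre s (U n)) (s[U]≡Δ n) ⟩
      pre s (U n) ++ Δ n ∷ pre s (U n)
        ∎
      where open ≡-Reasoning

    fresh⇒unique : ∀ x → x < U (suc n) → s x ≡ Δ n → x ≡ U n
    fresh⇒unique x x<U eq with <-cmp x (U n)
    ... | tri< x<Uₙ _ _ = ⊥-elim (fresh x x<Uₙ eq)
    ... | tri≈ _ x≡Uₙ _ = x≡Uₙ
    ... | tri> _ _ Uₙ<x =
      ⊥-elim (fresh t t<Uₙ (trans (sym (fresh⇒s-copy t t<Uₙ)) (trans (cong s Uₙ+t) eq)))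
      where
        t : ℕ
        t = x ∸ suc (U n)
        Uₙ+t : suc (U n + t) ≡ x
        Uₙ+t = m+[n∸m]≡n Uₙ<x
        t<Uₙ : t < U n
        t<Uₙ = +-cancelˡ-≤ (U n) (suc t) (U n) (subst (_≤ U n + U n) (sym (+-suc (U n) t))
                 (≤-pred (subst₂ _<_ (sym Uₙ+t) fresh⇒U-suc x<U)))

    fresh⇒occ≡0 : occ (Δ n) (pre s (U n)) ≡ 0
    fresh⇒occ≡0 = occ-pre≡0 (U n) fresh

module Prefix-ayaa {k : ℕ} {s Δ : InfWord k} (balanced : Balanced s) (directive : IsDirective Δ s)
  {a : Letter k} {j : ℕ} (1≤j : 1 ≤ j) (Δ₀≡a : Δ 0 ≡ a)
  (Δ-distinct : ∀ {m n} → m < n → n ≤ j → Δ m ≢ Δ n)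
  (Δ[1+j]≡a : Δ (suc j) ≡ a) (Δ[2+j]≡a : Δ (suc (suc j)) ≡ a) where

  open Directive directive

  Δ≢a : ∀ {i} → 1 ≤ i → i ≤ j → Δ i ≢ a
  Δ≢a 1≤i i≤j Δᵢ≡a = Δ-distinct 1≤i i≤j (trans Δ₀≡a (sym Δᵢ≡a))

  Δ-suc≢Δ : ∀ {i} → i ≤ j → Δ (suc i) ≢ Δ i
  Δ-suc≢Δ {i} i≤j with m≤n⇒m<n∨m≡n i≤j
  ... | inj₁ i<j  = λ eq → Δ-distinct (n<1+n i) i<j (sym eq)
  ... | inj₂ refl = λ eq → Δ≢a 1≤j ≤-refl (trans (sym eq) Δ[1+j]≡a)

  fresh-≤j : ∀ {i} → i ≤ j → Fresh i
  fresh-≤j {i} i≤j x x<U eq =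
    let m , m<i , sx≡Δₘ = occurs-earlier i x x<U in Δ-distinct m<i i≤j (trans (sym sx≡Δₘ) eq)

  s₀≡a : s 0 ≡ a
  s₀≡a = trans (cong s (sym U₀)) (trans (s[U]≡Δ 0) Δ₀≡a)

  U₁≡1 : U 1 ≡ 1
  U₁≡1 = trans (fresh⇒U-suc (fresh-≤j z≤n)) (cong (λ m → suc (m + m)) U₀)

  private
    J P L : ℕ
    J = U j
    P = U (suc j)
    L = U (suc (suc j))

    P≡2J+1 : P ≡ suc (J + J)
    P≡2J+1 = fresh⇒U-suc (fresh-≤j ≤-refl)

  -- Reflection in u (2 + j) sends J and P + 1 to positions w and v holding Δ j; as Δ j occurs in
  -- u (1 + j) only at J, w ≥ P (so that v exists) and then v = J.
  L≡P+J+2 : s (suc P) ≡ Δ j → L ≡ suc (suc P + J)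
  L≡P+J+2 s[1+P]≡Δⱼ = trans (sym P+v) (cong (λ m → suc (suc P + m)) v≡J)
    where
      open ≡-Reasoning
      unique-Δⱼ : ∀ x → x < P → s x ≡ Δ j → x ≡ J
      unique-Δⱼ = fresh⇒unique (fresh-≤j ≤-refl)
      w : ℕ
      w = L ∸ suc J
      J+w : suc (J + w) ≡ L
      J+w = m+[n∸m]≡n (<-trans (U<U-suc j) (U<U-suc (suc j)))
      s[w]≡Δⱼ : s w ≡ Δ j
      s[w]≡Δⱼ = trans (sym (U-mirror (suc (suc j)) J+w)) (s[U]≡Δ j)
      P≤w : P ≤ w
      P≤w = ≮⇒≥ λ w<P → <-irrefl (P≡L w<P) (U<U-suc (suc j))
        where
          P≡L : w < P → P ≡ L
          P≡L w<P = begin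
            P            ≡⟨ P≡2J+1 ⟩
            suc (J + J)  ≡⟨ cong (λ m → suc (J + m)) (unique-Δⱼ w w<P s[w]≡Δⱼ) ⟨
            suc (J + w)  ≡⟨ J+w ⟩
            L            ∎
      v : ℕ
      v = L ∸ suc (suc P)
      P+v : suc (suc P + v) ≡ L
      P+v = m+[n∸m]≡n (subst (suc (suc P) ≤_) J+w (s≤s (+-mono-≤ (≤-trans 1≤j (n≤U j)) P≤w)))
      v<P : v < P
      v<P = +-cancelˡ-≤ P (suc v) P (subst (_≤ P + P) (sym (+-suc P v))
              (≤-pred (subst (_≤ suc (P + P)) (sym P+v) (U-suc≤2U+1 (suc j)))))
      v≡J : v ≡ J
      v≡J = unique-Δⱼ v v<P (trans (sym (U-mirror (suc (suc j)) P+v)) s[1+P]≡Δⱼ)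

  s[1+P]≢Δⱼ : 2 ≤ j → s (suc P) ≢ Δ j
  s[1+P]≢Δⱼ 2≤j s[1+P]≡Δⱼ = Δ≢a (s≤s z≤n) 1≤j (sym (begin
    a                 ≡⟨ s₀≡a ⟨
    s 0               ≡⟨ U-mirror (suc j) (sym P≡2J+1) ⟩
    s (J + J)         ≡⟨ U-mirror (suc (suc j)) 2+J+2J≡L ⟨
    s (suc (suc J))   ≡⟨ cong (λ m → s (suc m)) (+-comm 1 J) ⟩
    s (suc (J + 1))   ≡⟨ fresh⇒s-copy (fresh-≤j ≤-refl) 1 (≤-trans 2≤j (n≤U j)) ⟩
    s 1               ≡⟨ cong s (sym U₁≡1) ⟩
    s (U 1)           ≡⟨ s[U]≡Δ 1 ⟩
    Δ 1               ∎))
    where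
      open ≡-Reasoning
      reassoc : ∀ J → suc (suc (suc J) + (J + J)) ≡ suc (suc (suc (J + J)) + J)
      reassoc = solve-∀
      2+J+2J≡L : suc (suc (suc J) + (J + J)) ≡ L
      2+J+2J≡L = trans (reassoc J)
        (trans (cong (λ m → suc (suc m + J)) (sym P≡2J+1)) (sym (L≡P+J+2 s[1+P]≡Δⱼ)))

  s[1+U[1+i]]≢Δᵢ : ∀ {i} → 2 ≤ j → 1 ≤ i → i ≤ j → s (suc (U (suc i))) ≢ Δ i
  s[1+U[1+i]]≢Δᵢ {i} 2≤j 1≤i i≤j with m≤n⇒m<n∨m≡n i≤j
  ... | inj₂ refl = s[1+P]≢Δⱼ 2≤j
  ... | inj₁ i<j  = λ eq → Δ≢a 1≤i i≤j (trans (sym eq) (begin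
    s (suc (U (suc i)))     ≡⟨ cong (λ m → s (suc m)) (+-identityʳ (U (suc i))) ⟨
    s (suc (U (suc i) + 0)) ≡⟨ fresh⇒s-copy (fresh-≤j i<j) 0 (≤-<-trans z≤n (U<U-suc i)) ⟩
    s 0                     ≡⟨ s₀≡a ⟩
    a                       ∎))
    where open ≡-Reasoning

  repeated-letter-unbalanced : ∀ {i N} → 2 ≤ j → 1 ≤ i → i ≤ j → i < N → Δ N ≢ Δ i
  repeated-letter-unbalanced {i} {N} 2≤j 1≤i i≤j i<N Δₙ≡Δᵢ =
    Balanced⇒occ≢2+occ {s = s} balanced p (suc m) (suc m + 1) (Δ i)
      (trans occ-around-N (cong (2 +_) (sym occ-after-uᵢ)))
    where
      m : ℕ
      m = U i
      fresh : Fresh i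
      fresh = fresh-≤j i≤j
      p : ℕ
      p = U N ∸ suc m
      p+m : p + suc m ≡ U N
      p+m = m∸n+n≡m (U-strictMono i<N)
      occ-around-N : occ (Δ i) (factor s p (suc m + 1)) ≡ 2
      occ-around-N = trans
        (occ-palindrome-window (U-palindrome N) p+m (s[U]≡Δ i) (trans (s[U]≡Δ N) Δₙ≡Δᵢ))
        (cong (2 +_) (fresh⇒occ≡0 fresh))
      avoid : ∀ t → t < suc (suc m) → s (suc (m + t)) ≢ Δ i
      avoid t t<2+m with m<1+n⇒m<n∨m≡n t<2+m
      ... | inj₂ refl = λ eq → s[1+U[1+i]]≢Δᵢ 2≤j 1≤i i≤j
              (trans (cong (λ x → s (suc x)) (sym (trans (+-suc m m) (sym (fresh⇒U-suc fresh))))) eq)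
      ... | inj₁ t<1+m with m<1+n⇒m<n∨m≡n t<1+m
      ...   | inj₂ refl = λ eq →
                Δ-suc≢Δ i≤j (trans (sym (s[U]≡Δ (suc i))) (trans (cong s (fresh⇒U-suc fresh)) eq))
      ...   | inj₁ t<m  = λ eq → fresh t t<m (trans (sym (fresh⇒s-copy fresh t t<m)) eq)
      occ-after-uᵢ : occ (Δ i) (factor s (suc m) (suc m + 1)) ≡ 0
      occ-after-uᵢ = occ-pre≡0 (suc m + 1) (λ t t< → avoid t (subst (t <_) (+-comm (suc m) 1) t<))

  new-letter-unbalanced : ∀ {N} → (∀ i → i ≤ j → Δ i ≢ Δ N) → (∀ m → m < N → Δ m ≢ Δ N) → ⊥
  new-letter-unbalanced {N} not-in-prefix first =
    Balanced⇒occ≢2+occ {s = s} balanced pG pH (suc P + 1) a (trans occ-G (cong (2 +_) (sym occ-H)))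
    where
      open ≡-Reasoning
      j<N : j < N
      j<N = ≰⇒> (λ N≤j → not-in-prefix N N≤j refl)
      Δₙ≢a : Δ N ≢ a
      Δₙ≢a Δₙ≡a = not-in-prefix 0 z≤n (trans Δ₀≡a (sym Δₙ≡a))
      fresh : Fresh N
      fresh x x<U eq = let m , m<N , sx≡Δₘ = occurs-earlier N x x<U in first m m<N (trans (sym sx≡Δₘ) eq)
      c : ℕ
      c = occ a (pre s J)
      occ-u[1+j] : occ a (pre s P) ≡ c + c
      occ-u[1+j] = trans (cong (occ a) (fresh⇒pre-U-suc (fresh-≤j ≤-refl)))
        (trans (occ-++ a (pre s J) _) (cong (c +_) (occ-∷-≢ (pre s J) (Δ≢a 1≤j ≤-refl))))
      occ-u[j]Δⱼ : occ a (pre s (suc J)) ≡ c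
      occ-u[j]Δⱼ = trans (cong (occ a) (pre-∷ʳ s J))
        (occ-∷ʳ-≢ (pre s J) (λ sJ≡a → Δ≢a 1≤j ≤-refl (trans (sym (s[U]≡Δ j)) sJ≡a)))
      pG : ℕ
      pG = L ∸ suc P
      pG+P : pG + suc P ≡ L
      pG+P = m∸n+n≡m (U<U-suc (suc j))
      occ-G : occ a (factor s pG (suc P + 1)) ≡ 2 + (c + c)
      occ-G = trans
        (occ-palindrome-window (U-palindrome (suc (suc j))) pG+P
          (trans (s[U]≡Δ (suc j)) Δ[1+j]≡a) (trans (s[U]≡Δ (suc (suc j))) Δ[2+j]≡a))
        (cong (2 +_) occ-u[1+j])
      pH : ℕ
      pH = U N ∸ suc J
      pH+J : pH + suc J ≡ U N
      pH+J = m∸n+n≡m (U-strictMono j<N)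
      window-length : suc P + 1 ≡ suc J + suc (suc J)
      window-length = trans (cong (λ m → suc m + 1) P≡2J+1) (sum J)
        where
          sum : ∀ J → suc (suc (J + J)) + 1 ≡ suc J + suc (suc J)
          sum = solve-∀
      occ-H : occ a (factor s pH (suc P + 1)) ≡ c + c
      occ-H = begin
        occ a (factor s pH (suc P + 1))
          ≡⟨ cong (λ n → occ a (factor s pH n)) window-length ⟩
        occ a (factor s pH (suc J + suc (suc J)))
          ≡⟨ cong (occ a) (palindrome-window {p = pH} {suc J} (suc (suc J)) (U-palindrome N) pH+J) ⟩
        occ a (reverse (pre s (suc J)) ++ factor s (U N) (suc (suc J)))
          ≡⟨ occ-++ a (reverse (pre s (suc J))) _ ⟩
        occ a (reverse (pre s (suc J))) + occ a (factor s (U N) (suc (suc J)))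
          ≡⟨ cong₂ (λ m xs → m + occ a xs) (occ-reverse a (pre s (suc J)))
               (trans (factor-suc s (U N) (suc J))
                      (cong₂ _∷_ (s[U]≡Δ N) (fresh⇒factor≡pre fresh (U-strictMono j<N)))) ⟩
        occ a (pre s (suc J)) + occ a (Δ N ∷ pre s (suc J))
          ≡⟨ cong (occ a (pre s (suc J)) +_) (occ-∷-≢ (pre s (suc J)) Δₙ≢a) ⟩
        occ a (pre s (suc J)) + occ a (pre s (suc J))
          ≡⟨ cong₂ _+_ occ-u[j]Δⱼ occ-u[j]Δⱼ ⟩
        c + c
          ∎

  Δ-in-prefix : ∀ N → ∃ λ i → i ≤ j × Δ N ≡ Δ i
  Δ-in-prefix N with anyUpTo? (λ i → Δ N ≟ Δ i) (suc j)
  ... | yes (i , i<1+j , eq) = i , ≤-pred i<1+j , eq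
  ... | no  not-in-prefix    with first-occurrence (λ m → Δ m ≟ Δ N) {N} refl
  ...   | M , Δₘ≡Δₙ , earlier = ⊥-elim (new-letter-unbalanced
            (λ i i≤j Δᵢ≡Δₘ → not-in-prefix (i , s≤s i≤j , sym (trans Δᵢ≡Δₘ Δₘ≡Δₙ)))
            (λ m m<M Δₘ≡Δ[M] → earlier m m<M (trans Δₘ≡Δ[M] Δₘ≡Δₙ)))

  s-in-prefix : ∀ x → ∃ λ i → i ≤ j × s x ≡ Δ i
  s-in-prefix x =
    let m , _ , sx≡Δₘ = occurs-earlier (suc x) x (≤-<-trans (n≤U x) (U<U-suc x))
        i , i≤j , Δₘ≡Δᵢ = Δ-in-prefix m
    in i , i≤j , trans sx≡Δₘ Δₘ≡Δᵢ

  three-letters⇒2≤j : AtLeastThreeLetters s → 2 ≤ j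
  three-letters⇒2≤j (x , y , z , x≢y , x≢z , y≢z) with m≤n⇒m<n∨m≡n 1≤j
  ... | inj₁ 1<j = 1<j
  ... | inj₂ 1≡j = ⊥-elim (pigeonhole (two-letters x) (two-letters y) (two-letters z) x≢y x≢z y≢z)
    where
      two-letters : ∀ x → s x ≡ Δ 0 ⊎ s x ≡ Δ 1
      two-letters x with s-in-prefix x
      ... | i , i≤j , sx≡Δᵢ with subst (i ≤_) (sym 1≡j) i≤j
      ...   | z≤n       = inj₁ sx≡Δᵢ
      ...   | s≤s z≤n   = inj₂ sx≡Δᵢ

  Δ-beyond≡a : AtLeastThreeLetters s → ∀ {N} → j < N → Δ N ≡ a
  Δ-beyond≡a three {N} j<N with Δ-in-prefix N
  ... | zero  , _     , Δₙ≡Δ₀ = trans Δₙ≡Δ₀ Δ₀≡a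
  ... | suc i , 1+i≤j , Δₙ≡Δᵢ =
    ⊥-elim (repeated-letter-unbalanced (three-letters⇒2≤j three) (s≤s z≤n) 1+i≤j (≤-<-trans 1+i≤j j<N) Δₙ≡Δᵢ)

proposition3p12 : (k : ℕ) (s Δ : InfWord k) →
    Balanced s → AtLeastThreeLetters s → IsDirective Δ s →
    (a : Letter k) (y : Word k) (ℓ : ℕ) (z : InfWord k) →
    y ≢ [] → Unique y → occ a y ≡ 0 → 2 ≤ ℓ →
    (∀ n → Δ n ≡ ((a ∷ y ++ replicate ℓ a) ++ω z) n) →
    ∀ n → Δ n ≡ ((a ∷ y) ++ω constω a) n
proposition3p12 k s Δ balanced three directive a [] ℓ z y≢[] _ _ _ _ = ⊥-elim (y≢[] refl)
proposition3p12 k s Δ balanced three directive a y@(_ ∷ _) ℓ z _ unique-y a∉y (s≤s (s≤s z≤n)) Δ≡ = Δ≡ay·aω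
  where
    j : ℕ
    j = length y
    w : InfWord k
    w = replicate ℓ a ++ω z
    Δ≡ay·w : ∀ n → Δ n ≡ ((a ∷ y) ++ω w) n
    Δ≡ay·w n = trans (Δ≡ n) (++ω-++ (a ∷ y) (replicate ℓ a) z n)
    Δ-distinct : ∀ {m n} → m < n → n ≤ j → Δ m ≢ Δ n
    Δ-distinct m<n n≤j Δₘ≡Δₙ = Unique-++ω (occ≡0⇒All≢ a∉y ∷ unique-y) m<n (s≤s n≤j)
      (trans (sym (Δ≡ay·w _)) (trans Δₘ≡Δₙ (Δ≡ay·w _)))
    -- ℓ was matched as 2 + ℓ′, so w 0 and w 1 reduce to a.
    Δ[1+j]≡a : Δ (suc j) ≡ a
    Δ[1+j]≡a = trans (Δ≡ay·w (suc j)) (trans (++ω-beyond (a ∷ y) ≤-refl) (cong w (n∸n≡0 (suc j))))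
    Δ[2+j]≡a : Δ (suc (suc j)) ≡ a
    Δ[2+j]≡a = trans (Δ≡ay·w (suc (suc j)))
      (trans (++ω-beyond (a ∷ y) (n≤1+n (suc j))) (cong w (m+n∸n≡m 1 (suc j))))
    open Prefix-ayaa balanced directive (s≤s z≤n) (Δ≡ 0) Δ-distinct Δ[1+j]≡a Δ[2+j]≡a
    Δ≡ay·aω : ∀ n → Δ n ≡ ((a ∷ y) ++ω constω a) n
    Δ≡ay·aω n with n <? suc j
    ... | yes n<1+j = trans (Δ≡ay·w n) (++ω-prefix (a ∷ y) n<1+j)
    ... | no  n≮1+j = trans (Δ-beyond≡a three (≮⇒≥ n≮1+j)) (sym (++ω-beyond (a ∷ y) (≮⇒≥ n≮1+j)))
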